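{- Let $p=(12,\{(0,0),(0,1),(0,2),(1,2),(2,0),(2,2)\})$ and $n\ge 2$. For each $1\le i\le n-1$, the number of permutations $\pi\in S_n$ with $\pi_{n-i+1}=n$ (i.e. $n$ is in position $i$ counted from the right, the rightmost position being $1$) that contain $p$ is $\frac{(n-1)!}{i}$. Consequently \[|S_n(p)| = n!-\sum_{i=1}^{n-1}\frac{(n-1)!}{i}.\]
   Context: $S_n$ is the set of permutations of $\{1,\dots,n\}$, written $\pi=\pi_1\cdots\pi_n$. A mesh pattern $(12,R)$ of length 2 has $R\subseteq\{0,1,2\}^2$ (shaded boxes). A permutation $\pi\in S_n$ contains $(12,R)$ if there exist indices $i<j$ with $\pi_i<\pi_j$ such that, with $p_0=0,p_1=i,p_2=j,p_3=n+1$ and $v_0=0,v_1=\pi_i,v_2=\pi_j,v_3=n+1$, for every $(a,b)\in R$ there is no index $x$ with $p_a<x<p_{a+1}$ and $v_b<\pi_x<v_{b+1}$. Otherwise $\pi$ avoids it; $S_n(p)$ is the set of avoiders in $S_n$. -}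

module Defs where

open import Data.Nat using (ℕ; zero; suc; _<?_; _≟_; _∸_)
open import Data.Fin using (Fin; toℕ)
import Data.Fin as F
open import Data.Bool.ListAction using (any; all)
open import Data.Fin.Properties using () renaming (_≟_ to _≟ᶠ_)
open import Data.Bool using (Bool; true; false; _∧_; not)
import Data.Bool as B
import Data.Nat as N
open import Data.List using (List; []; _∷_; map; concatMap; filter; length; allFin)
open import Data.Vec using (Vec; []; _∷_; lookup)
open import Data.Product using (_×_; _,_)
open import Relation.Nullary.Decidable using (⌊_⌋)
open import Relation.Unary using (Pred)
open import Relation.Binary.PropositionalEquality using (_≡_)

-- A permutation π ∈ S_n is represented as v : Vec (Fin n) n with pairwise
-- distinct entries, via π_{x+1} = toℕ (lookup v x) + 1 (1-based positions/values).

allVecs : (n m : ℕ) → List (Vec (Fin n) m)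
allVecs n zero = [] ∷ []
allVecs n (suc m) = concatMap (λ a → map (a ∷_) (allVecs n m)) (allFin n)

distinctB : ∀ {n m} → Vec (Fin n) m → Bool
distinctB {m = m} v =
  all (λ x → all (λ y → ⌊ toℕ x ≟ toℕ y ⌋ ∨' not ⌊ lookup v x ≟ᶠ lookup v y ⌋) (allFin m)) (allFin m)
  where
  _∨'_ : Bool → Bool → Bool
  true ∨' _ = true
  false ∨' b = b

Sn : (n : ℕ) → List (Vec (Fin n) n)
Sn n = filter (λ v → B._≟_ (distinctB v) true) (allVecs n n)

pos : ∀ {n} → Fin n → ℕ
pos x = suc (toℕ x)

val : ∀ {n} → Vec (Fin n) n → Fin n → ℕ
val v x = suc (toℕ (lookup v x))

_<ᵇ_ : ℕ → ℕ → Bool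
a <ᵇ b = ⌊ a <? b ⌋

-- grid lines p_0 = 0, p_1 = i, p_2 = j, p_3 = n+1 (likewise for values)
line : (n : ℕ) → ℕ → ℕ → Fin 4 → ℕ
line n i j F.zero = 0
line n i j (F.suc F.zero) = i
line n i j (F.suc (F.suc F.zero)) = j
line n i j (F.suc (F.suc (F.suc F.zero))) = suc n

boxEmpty : ∀ {n} → Vec (Fin n) n → Fin n → Fin n → Fin 3 × Fin 3 → Bool
boxEmpty {n} v i j (a , b) =
  not (any (λ x → (line n (pos i) (pos j) (F.inject₁ a) <ᵇ pos x)
                ∧ (pos x <ᵇ line n (pos i) (pos j) (F.suc a))
                ∧ (line n (val v i) (val v j) (F.inject₁ b) <ᵇ val v x)
                ∧ (val v x <ᵇ line n (val v i) (val v j) (F.suc b)))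
           (allFin n))

contains12 : ∀ {n} → List (Fin 3 × Fin 3) → Vec (Fin n) n → Bool
contains12 {n} R v =
  any (λ i → any (λ j → (pos i <ᵇ pos j) ∧ (val v i <ᵇ val v j) ∧ all (boxEmpty v i j) R)
                 (allFin n))
      (allFin n)

f0 f1 f2 : Fin 3
f0 = F.zero
f1 = F.suc F.zero
f2 = F.suc (F.suc F.zero)

Rp : List (Fin 3 × Fin 3)
Rp = (f0 , f0) ∷ (f0 , f1) ∷ (f0 , f2) ∷ (f1 , f2) ∷ (f2 , f0) ∷ (f2 , f2) ∷ []

nAtRight : ∀ {n} → ℕ → Vec (Fin n) n → Bool
nAtRight {n} i v = any (λ x → ⌊ pos x ≟ (n ∸ i) N.+ 1 ⌋ ∧ ⌊ val v x ≟ n ⌋) (allFin n)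

countSn : (n : ℕ) → (Vec (Fin n) n → Bool) → ℕ
countSn n t = length (filter (λ v → B._≟_ (t v) true) (Sn n))

-- A permutation π ∈ S_n contains p exactly when n is not π₁ and every entry to the right of n
-- exceeds π₁; the occurrence is then (π₁, n), since the shaded boxes force the first point to
-- be leftmost and the second to be topmost. Fix n at position i from the right and π₁ = a + 1.
-- The i − 1 entries after n are then an arrangement of i − 1 of the n − 2 − a values in
-- (a + 1, n), and the r = n − 1 − i entries between π₁ and n an arrangement of the rest, so
-- there are (n − 2 − a)^(i − 1 falling) · r! such permutations. Summing over a with the
-- hockey-stick identity gives (n − 1)^(i falling) · r! / i = (n − 1)! / i. A containing
-- permutation has n in exactly one of the positions 1, …, n − 1 from the right, which gives
-- the number of avoiders.

module Submission where

open import Defs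
open import Data.Nat using (ℕ; suc; _≤_; _∸_; _/_; >-nonZero; _!)
open import Data.Bool using (_∧_; not)
open import Data.List using (map; upTo)
open import Data.Nat.ListAction using (sum)
open import Data.Product using (_×_)
open import Relation.Binary.PropositionalEquality using (_≡_)

open import Data.Bool using (Bool; true; false; T)
import Data.Bool as Bool
open import Data.Bool.ListAction using (any; all)
open import Data.Bool.Properties using (T-∧; T-≡; T?; ∧-comm; ∧-zeroʳ; ∧-identityʳ)
open import Data.Empty using (⊥; ⊥-elim)
open import Data.Fin using (Fin; toℕ)
import Data.Fin as Fin
open import Data.Fin.Properties
  using (toℕ-injective; toℕ<n; toℕ-fromℕ; toℕ-inject₁; pigeonhole; lower₁-injective; any?)
  renaming (_≟_ to _≟ᶠ_; suc-injective to Fin-suc-injective)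
open import Data.List using (List; []; _∷_; _++_; filter; length; concatMap; tabulate; applyUpTo; allFin)
open import Data.List.Membership.Propositional using (lose)
open import Data.List.Membership.Propositional.Properties using (∈-allFin)
open import Data.List.Properties using (map-tabulate; map-applyUpTo)
open import Data.List.Relation.Unary.All as All using (All; []; _∷_)
open import Data.List.Relation.Unary.All.Properties using (all⁺; all⁻; ¬All⇒Any¬)
open import Data.List.Relation.Unary.Any using (satisfied)
open import Data.List.Relation.Unary.Any.Properties using (any⁺; any⁻)
open import Data.Nat using (zero; _+_; _*_; _<_; pred; z≤n; s≤s; s≤s⁻¹; z<s; _≤?_; _<?_; _≟_)
open import Data.Nat.DivMod using (m*n/n≡m)
open import Data.Nat.Properties
open import Algebra.Properties.Semiring.Sum +-*-semiring
  using (sum-syntax; sum-cong-≗; sum-replicate-zero; ∑-distrib-+; *-distribˡ-sum; *-distribʳ-sum; sum-init-last)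
  renaming (sum to ∑)
open import Data.Product using (_,_; ∃; ∃₂; proj₁; proj₂)
open import Data.Vec using (Vec; []; _∷_; lookup)
open import Function using (_∘_; _⇔_; mk⇔; Equivalence; case_of_)
open import Function.Definitions using (Injective)
open import Relation.Binary.Definitions using (tri<; tri≈; tri>)
open import Relation.Binary.PropositionalEquality using (_≢_; refl; sym; trans; cong; cong₂; subst; module ≡-Reasoning)
open import Relation.Nullary using (¬_)
open import Relation.Nullary.Decidable using (⌊_⌋; yes; no; toWitness; fromWitness)

open Equivalence using (to; from)

-- Counting boolean predicates

𝟙 : Bool → ℕ
𝟙 true  = 1
𝟙 false = 0

T-⇔⇒≡ : ∀ {a b} → T a ⇔ T b → a ≡ b
T-⇔⇒≡ {false} {false} _   = refl
T-⇔⇒≡ {false} {true}  a⇔b = ⊥-elim (from a⇔b _)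
T-⇔⇒≡ {true}  {false} a⇔b = ⊥-elim (to a⇔b _)
T-⇔⇒≡ {true}  {true}  _   = refl

T-<ᵇ : ∀ {a b} → T (a <ᵇ b) ⇔ a < b
T-<ᵇ = mk⇔ toWitness fromWitness

T-≟ : ∀ {a b : ℕ} → T ⌊ a ≟ b ⌋ ⇔ a ≡ b
T-≟ = mk⇔ toWitness fromWitness

T-not : ∀ {b} → T (not b) ⇔ (¬ T b)
T-not {false} = mk⇔ (λ _ ()) (λ _ → _)
T-not {true}  = mk⇔ (λ ()) (λ ¬b → ¬b _)

<ᵇ-irrefl : ∀ a → (a <ᵇ a) ≡ false
<ᵇ-irrefl a with a <? a
... | yes a<a = ⊥-elim (<-irrefl refl a<a)
... | no _    = refl

∧-rotate : ∀ a b c → (a ∧ b) ∧ c ≡ (a ∧ c) ∧ b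
∧-rotate true  b c = ∧-comm b c
∧-rotate false b c = refl

count : {A : Set} → (A → Bool) → List A → ℕ
count P []       = 0
count P (x ∷ xs) = 𝟙 (P x) + count P xs

module _ {A : Set} where

  length-filter : ∀ (P : A → Bool) xs → length (filter (λ x → P x Bool.≟ true) xs) ≡ count P xs
  length-filter P []       = refl
  length-filter P (x ∷ xs) with P x
  ... | true  = cong suc (length-filter P xs)
  ... | false = length-filter P xs

  count-filter : ∀ (P Q : A → Bool) xs →
                 count P (filter (λ x → Q x Bool.≟ true) xs) ≡ count (λ x → Q x ∧ P x) xs
  count-filter P Q []       = refl
  count-filter P Q (x ∷ xs) with Q x
  ... | true  = cong (𝟙 (P x) +_) (count-filter P Q xs)
  ... | false = count-filter P Q xs

  count-cong : ∀ {P Q : A → Bool} → (∀ x → P x ≡ Q x) → ∀ xs → count P xs ≡ count Q xs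
  count-cong P≗Q []       = refl
  count-cong P≗Q (x ∷ xs) = cong₂ _+_ (cong 𝟙 (P≗Q x)) (count-cong P≗Q xs)

  count-++ : ∀ (P : A → Bool) xs ys → count P (xs ++ ys) ≡ count P xs + count P ys
  count-++ P []       ys = refl
  count-++ P (x ∷ xs) ys = trans (cong (𝟙 (P x) +_) (count-++ P xs ys)) (sym (+-assoc (𝟙 (P x)) _ _))

  count-const-∧ : ∀ b (P : A → Bool) xs → count (λ x → b ∧ P x) xs ≡ 𝟙 b * count P xs
  count-const-∧ true  P xs = sym (+-identityʳ (count P xs))
  count-const-∧ false P []       = refl
  count-const-∧ false P (x ∷ xs) = count-const-∧ false P xs

  count-∧-not : ∀ (Q P : A → Bool) xs →
                count (λ x → Q x ∧ P x) xs + count (λ x → Q x ∧ not (P x)) xs ≡ count Q xs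
  count-∧-not Q P []       = refl
  count-∧-not Q P (x ∷ xs) with Q x | P x
  ... | false | _     = count-∧-not Q P xs
  ... | true  | true  = cong suc (count-∧-not Q P xs)
  ... | true  | false = trans (+-suc _ _) (cong suc (count-∧-not Q P xs))

  count-∑ : ∀ {k} (P : A → Bool) (Pᵢ : Fin k → A → Bool) →
            (∀ x → 𝟙 (P x) ≡ ∑[ i < k ] 𝟙 (Pᵢ i x)) →
            ∀ xs → count P xs ≡ ∑[ i < k ] count (Pᵢ i) xs
  count-∑ {k} P Pᵢ split []       = sym (sum-replicate-zero k)
  count-∑ {k} P Pᵢ split (x ∷ xs) = begin
    𝟙 (P x) + count P xs
      ≡⟨ cong₂ _+_ (split x) (count-∑ P Pᵢ split xs) ⟩
    ∑[ i < k ] 𝟙 (Pᵢ i x) + ∑[ i < k ] count (Pᵢ i) xs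
      ≡⟨ sym (∑-distrib-+ (λ i → 𝟙 (Pᵢ i x)) (λ i → count (Pᵢ i) xs)) ⟩
    ∑[ i < k ] count (Pᵢ i) (x ∷ xs) ∎
    where open ≡-Reasoning

count-map : ∀ {A B : Set} (P : B → Bool) (f : A → B) xs → count P (map f xs) ≡ count (P ∘ f) xs
count-map P f []       = refl
count-map P f (x ∷ xs) = cong (𝟙 (P (f x)) +_) (count-map P f xs)

count-concatMap : ∀ {A B : Set} (P : B → Bool) (f : A → List B) xs →
                  count P (concatMap f xs) ≡ sum (map (count P ∘ f) xs)
count-concatMap P f []       = refl
count-concatMap P f (x ∷ xs) =
  trans (count-++ P (f x) (concatMap f xs)) (cong (count P (f x) +_) (count-concatMap P f xs))

any-allFin⁻ : ∀ {n} (P : Fin n → Bool) → T (any P (allFin n)) → ∃ (T ∘ P)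
any-allFin⁻ P = satisfied ∘ any⁻ P (allFin _)

any-allFin⁺ : ∀ {n} (P : Fin n → Bool) x → T (P x) → T (any P (allFin n))
any-allFin⁺ P x Px = any⁺ P (lose (∈-allFin x) Px)

sum-tabulate : ∀ {n} (f : Fin n → ℕ) → sum (tabulate f) ≡ ∑[ i < n ] f i
sum-tabulate {zero}  f = refl
sum-tabulate {suc n} f = cong (f Fin.zero +_) (sum-tabulate (f ∘ Fin.suc))

sum-applyUpTo : ∀ (f : ℕ → ℕ) n → sum (applyUpTo f n) ≡ ∑[ i < n ] f (toℕ i)
sum-applyUpTo f zero    = refl
sum-applyUpTo f (suc n) = cong (f 0 +_) (sum-applyUpTo (f ∘ suc) n)

sum-upTo : ∀ (f : ℕ → ℕ) n → sum (map f (upTo n)) ≡ ∑[ i < n ] f (toℕ i)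
sum-upTo f n = trans (cong sum (map-applyUpTo (λ i → i) f n)) (sum-applyUpTo f n)

-- Subsets of Fin n

module _ {n : ℕ} where

  _==_ : Fin n → Fin n → Bool
  x == y = ⌊ x ≟ᶠ y ⌋

  ==-refl : ∀ x → (x == x) ≡ true
  ==-refl x with x ≟ᶠ x
  ... | yes _  = refl
  ... | no x≢x = ⊥-elim (x≢x refl)

  ==-sym : ∀ x y → (x == y) ≡ (y == x)
  ==-sym x y with x ≟ᶠ y | y ≟ᶠ x
  ... | yes _   | yes _   = refl
  ... | no _    | no _    = refl
  ... | yes x≡y | no y≢x  = ⊥-elim (y≢x (sym x≡y))
  ... | no x≢y  | yes y≡x = ⊥-elim (x≢y (sym y≡x))

  ==-≢ : ∀ {x y} → x ≢ y → (x == y) ≡ false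
  ==-≢ {x} {y} x≢y with x ≟ᶠ y
  ... | yes x≡y = ⊥-elim (x≢y x≡y)
  ... | no _    = refl

  T-== : ∀ {x y} → T (x == y) ⇔ x ≡ y
  T-== {x} {y} with x ≟ᶠ y
  ... | yes x≡y = mk⇔ (λ _ → x≡y) (λ _ → _)
  ... | no x≢y  = mk⇔ (λ ()) x≢y

==-suc : ∀ {n} (x y : Fin n) → (Fin.suc x == Fin.suc y) ≡ (x == y)
==-suc x y with x ≟ᶠ y
... | yes _ = refl
... | no _  = refl

card : ∀ {n} → (Fin n → Bool) → ℕ
card {n} S = ∑[ a < n ] 𝟙 (S a)

_∖_ : ∀ {n} → (Fin n → Bool) → Fin n → Fin n → Bool
(S ∖ x) y = S y ∧ not (y == x)

_∩_ : ∀ {n} → (Fin n → Bool) → (Fin n → Bool) → Fin n → Bool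
(S ∩ G) y = S y ∧ G y

∁ : ∀ {n} → (Fin n → Bool) → Fin n → Bool
∁ G y = not (G y)

infixl 7 _∖_
infixl 6 _∩_

T-∖⁻ : ∀ {n} {S : Fin n → Bool} {x y} → T ((S ∖ x) y) → T (S y) × y ≢ x
T-∖⁻ {S = S} {x} {y} h with y ≟ᶠ x | S y
... | no y≢x | true = _ , y≢x

T-∖⁺ : ∀ {n} {S : Fin n → Bool} {x y} → T (S y) → y ≢ x → T ((S ∖ x) y)
T-∖⁺ {S = S} {x} {y} Sy y≢x with y ≟ᶠ x | S y
... | yes y≡x | _    = ⊥-elim (y≢x y≡x)
... | no _    | true = _

∖-∖-comm : ∀ {n} (S : Fin n → Bool) x y z → (S ∖ x ∖ y) z ≡ (S ∖ y ∖ x) z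
∖-∖-comm S x y z = ∧-rotate (S z) (not (z == x)) (not (z == y))

∖-∩-comm : ∀ {n} (S G : Fin n → Bool) x z → (S ∖ x ∩ G) z ≡ ((S ∩ G) ∖ x) z
∖-∩-comm S G x z = ∧-rotate (S z) (not (z == x)) (G z)

∑-𝟙-== : ∀ {n} (f : Fin n → ℕ) x → ∑[ a < n ] (𝟙 (a == x) * f a) ≡ f x
∑-𝟙-== {suc n} f Fin.zero    =
  trans (cong₂ _+_ (*-identityˡ (f Fin.zero)) (sum-replicate-zero n)) (+-identityʳ (f Fin.zero))
∑-𝟙-== {suc n} f (Fin.suc x) =
  trans (sum-cong-≗ {n} (λ a → cong (λ b → 𝟙 b * f (Fin.suc a)) (==-suc a x))) (∑-𝟙-== (f ∘ Fin.suc) x)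

card-single : ∀ {n} (x : Fin n) → card (_== x) ≡ 1
card-single {n} x = trans (sum-cong-≗ {n} (λ a → sym (*-identityʳ (𝟙 (a == x))))) (∑-𝟙-== (λ _ → 1) x)

card-all : ∀ n → card {n} (λ _ → true) ≡ n
card-all zero    = refl
card-all (suc n) = cong suc (card-all n)

card-cong : ∀ {n} {S G : Fin n → Bool} → (∀ y → S y ≡ G y) → card S ≡ card G
card-cong {n} S≗G = sum-cong-≗ {n} (cong 𝟙 ∘ S≗G)

card-∖ : ∀ {n} (S : Fin n → Bool) x → S x ≡ true → card S ≡ suc (card (S ∖ x))
card-∖ {n} S x Sx = begin
  card S                                ≡⟨ sum-cong-≗ {n} split ⟩
  ∑[ y < n ] (𝟙 ((S ∖ x) y) + 𝟙 (y == x)) ≡⟨ ∑-distrib-+ (𝟙 ∘ (S ∖ x)) (𝟙 ∘ (_== x)) ⟩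
  card (S ∖ x) + card (_== x)             ≡⟨ cong (card (S ∖ x) +_) (card-single x) ⟩
  card (S ∖ x) + 1                        ≡⟨ +-comm (card (S ∖ x)) 1 ⟩
  suc (card (S ∖ x))                      ∎
  where
  open ≡-Reasoning
  split : ∀ y → 𝟙 (S y) ≡ 𝟙 ((S ∖ x) y) + 𝟙 (y == x)
  split y with y ≟ᶠ x
  ... | yes refl rewrite Sx = refl
  ... | no _ with S y
  ...   | true  = refl
  ...   | false = refl

card-∖-∉ : ∀ {n} (S : Fin n → Bool) x → S x ≡ false → card (S ∖ x) ≡ card S
card-∖-∉ S x Sx = card-cong same
  where
  same : ∀ y → (S ∖ x) y ≡ S y
  same y with y ≟ᶠ x
  ... | yes refl rewrite Sx = refl
  ... | no _ with S y
  ...   | true  = refl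
  ...   | false = refl

𝟙-*-card-∖ : ∀ {n} (f : ℕ → ℕ) (S : Fin n → Bool) x →
             𝟙 (S x) * f (card (S ∖ x)) ≡ 𝟙 (S x) * f (pred (card S))
𝟙-*-card-∖ f S x with S x in Sx
... | true  = cong (λ c → 1 * f (pred c)) (sym (card-∖ S x Sx))
... | false = refl

𝟙-∖-swap : ∀ {n} (S : Fin n → Bool) x y → 𝟙 (S x) * 𝟙 ((S ∖ x) y) ≡ 𝟙 (S y) * 𝟙 ((S ∖ y) x)
𝟙-∖-swap S x y rewrite ==-sym y x with S x | S y | x == y
... | true  | true  | _     = refl
... | true  | false | _     = refl
... | false | true  | true  = refl
... | false | true  | false = refl
... | false | false | _     = refl

card-∩-∁ : ∀ {n} (S G : Fin n → Bool) → card (S ∩ G) + card (S ∩ ∁ G) ≡ card S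
card-∩-∁ {n} S G = trans (sym (∑-distrib-+ (𝟙 ∘ (S ∩ G)) (𝟙 ∘ (S ∩ ∁ G)))) (sum-cong-≗ {n} split)
  where
  split : ∀ y → 𝟙 ((S ∩ G) y) + 𝟙 ((S ∩ ∁ G) y) ≡ 𝟙 (S y)
  split y with S y | G y
  ... | true  | true  = refl
  ... | true  | false = refl
  ... | false | _     = refl

𝟙-*-card-∩-∖ : ∀ {n} (Φ : ℕ → ℕ → ℕ) (S G : Fin n → Bool) a →
  𝟙 (S a) * Φ (card ((S ∩ G) ∖ a)) (card (S ∖ a))
  ≡ 𝟙 ((S ∩ G) a) * Φ (pred (card (S ∩ G))) (pred (card S))
  + 𝟙 ((S ∩ ∁ G) a) * Φ (card (S ∩ G)) (pred (card S))
𝟙-*-card-∩-∖ Φ S G a with S a in Sa | G a in Ga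
... | false | _     = refl
... | true  | true  = sym (trans (+-identityʳ _) (cong₂ (λ g c → 1 * Φ (pred g) (pred c))
                        (card-∖ (S ∩ G) a (cong₂ _∧_ Sa Ga)) (card-∖ S a Sa)))
... | true  | false = cong₂ (λ g c → 1 * Φ g c)
                        (card-∖-∉ (S ∩ G) a (cong₂ _∧_ Sa Ga)) (sym (cong pred (card-∖ S a Sa)))

𝟙-*-card-∖-∖ : ∀ {n} (Φ : ℕ → ℕ → ℕ) (S G : Fin n → Bool) x a →
  𝟙 (S a) * (𝟙 ((S ∖ a) x) * Φ (card (S ∖ a ∖ x ∩ G)) (card (S ∖ a ∖ x)))
  ≡ 𝟙 (S x) * (𝟙 ((S ∖ x ∩ G) a) * Φ (pred (card (S ∖ x ∩ G))) (pred (card (S ∖ x)))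
             + 𝟙 ((S ∖ x ∩ ∁ G) a) * Φ (card (S ∖ x ∩ G)) (pred (card (S ∖ x))))
𝟙-*-card-∖-∖ Φ S G x a = begin
  𝟙 (S a) * (𝟙 ((S ∖ a) x) * Φ (card (S ∖ a ∖ x ∩ G)) (card (S ∖ a ∖ x)))
    ≡⟨ *-assoc (𝟙 (S a)) _ _ ⟨
  𝟙 (S a) * 𝟙 ((S ∖ a) x) * Φ (card (S ∖ a ∖ x ∩ G)) (card (S ∖ a ∖ x))
    ≡⟨ cong₂ _*_ (𝟙-∖-swap S a x) (cong₂ Φ (card-cong removals-commute) (card-cong (∖-∖-comm S a x))) ⟩
  𝟙 (S x) * 𝟙 ((S ∖ x) a) * Φ (card ((S ∖ x ∩ G) ∖ a)) (card (S ∖ x ∖ a))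
    ≡⟨ *-assoc (𝟙 (S x)) _ _ ⟩
  𝟙 (S x) * (𝟙 ((S ∖ x) a) * Φ (card ((S ∖ x ∩ G) ∖ a)) (card (S ∖ x ∖ a)))
    ≡⟨ cong (𝟙 (S x) *_) (𝟙-*-card-∩-∖ Φ (S ∖ x) G a) ⟩
  𝟙 (S x) * (𝟙 ((S ∖ x ∩ G) a) * Φ (pred (card (S ∖ x ∩ G))) (pred (card (S ∖ x)))
             + 𝟙 ((S ∖ x ∩ ∁ G) a) * Φ (card (S ∖ x ∩ G)) (pred (card (S ∖ x)))) ∎
  where
  open ≡-Reasoning
  removals-commute : ∀ z → (S ∖ a ∖ x ∩ G) z ≡ ((S ∖ x ∩ G) ∖ a) z
  removals-commute z = trans (cong (_∧ G z) (∖-∖-comm S a x z)) (∖-∩-comm (S ∖ x) G a z)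

card-> : ∀ n c → card {n} (λ y → c <ᵇ toℕ y) ≡ n ∸ suc c
card-> zero    c       = refl
card-> (suc n) zero    = card-all n
card-> (suc n) (suc c) = trans (sum-cong-≗ {n} (cong 𝟙 ∘ <ᵇ-suc c ∘ toℕ)) (card-> n c)
  where
  <ᵇ-suc : ∀ a b → (suc a <ᵇ suc b) ≡ (a <ᵇ b)
  <ᵇ-suc a b with suc a <? suc b | a <? b
  ... | yes _       | yes _   = refl
  ... | no _        | no _    = refl
  ... | no 1+a≮1+b  | yes a<b = ⊥-elim (1+a≮1+b (s≤s a<b))
  ... | yes 1+a<1+b | no a≮b  = ⊥-elim (a≮b (s≤s⁻¹ 1+a<1+b))

∑-𝟙-*-+ : ∀ {n} (P Q : Fin n → Bool) s x y →
          ∑[ a < n ] (s * (𝟙 (P a) * x + 𝟙 (Q a) * y)) ≡ s * (card P * x + card Q * y)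
∑-𝟙-*-+ {n} P Q s x y = begin
  ∑[ a < n ] (s * (𝟙 (P a) * x + 𝟙 (Q a) * y))
    ≡⟨ sym (*-distribˡ-sum s (λ a → 𝟙 (P a) * x + 𝟙 (Q a) * y)) ⟩
  s * ∑[ a < n ] (𝟙 (P a) * x + 𝟙 (Q a) * y)
    ≡⟨ cong (s *_) (∑-distrib-+ (λ a → 𝟙 (P a) * x) (λ a → 𝟙 (Q a) * y)) ⟩
  s * (∑[ a < n ] (𝟙 (P a) * x) + ∑[ a < n ] (𝟙 (Q a) * y))
    ≡⟨ cong (s *_) (sym (cong₂ _+_ (*-distribʳ-sum x (𝟙 ∘ P)) (*-distribʳ-sum y (𝟙 ∘ Q)))) ⟩
  s * (card P * x + card Q * y) ∎
  where open ≡-Reasoning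

-- Falling factorials

falling : ℕ → ℕ → ℕ
falling c zero    = 1
falling c (suc k) = c * falling (pred c) k

falling-zero : ∀ {c k} → c < k → falling c k ≡ 0
falling-zero {zero}  {suc k} _         = refl
falling-zero {suc c} {suc k} (s≤s c<k) = trans (cong (suc c *_) (falling-zero c<k)) (*-zeroʳ (suc c))

falling-sucʳ : ∀ c k → falling c (suc k) ≡ falling c k * (c ∸ k)
falling-sucʳ c       zero    = trans (*-identityʳ c) (sym (+-identityʳ c))
falling-sucʳ zero    (suc k) = refl
falling-sucʳ (suc c) (suc k) =
  trans (cong (suc c *_) (falling-sucʳ c k)) (sym (*-assoc (suc c) (falling c k) (c ∸ k)))

falling-self : ∀ c → falling c c ≡ c !
falling-self zero    = refl
falling-self (suc c) = cong (suc c *_) (falling-self c)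

falling-*-! : ∀ k r → falling (k + r) k * r ! ≡ (k + r) !
falling-*-! zero    r = *-identityˡ (r !)
falling-*-! (suc k) r =
  trans (*-assoc (suc (k + r)) (falling (k + r) k) (r !)) (cong (suc (k + r) *_) (falling-*-! k r))

falling-*-∸-+ : ∀ g b k → falling g k * (g ∸ k + b) ≡ falling g k * (g + b ∸ k)
falling-*-∸-+ g b k with k ≤? g
... | yes k≤g = cong (falling g k *_) (sym (+-∸-comm b k≤g))
... | no  k≰g = trans (cong (_* (g ∸ k + b)) g↓k≡0) (sym (cong (_* (g + b ∸ k)) g↓k≡0))
  where
  g↓k≡0 : falling g k ≡ 0
  g↓k≡0 = falling-zero (≰⇒> k≰g)

falling-step : ∀ g b k x →
  g * (falling (pred g) k * x) + b * (falling g k * x) ≡ falling g k * ((g + b ∸ k) * x)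
falling-step g b k x = begin
  g * (falling (pred g) k * x) + b * (falling g k * x)
    ≡⟨ cong₂ _+_ (sym (*-assoc g _ x)) (sym (*-assoc b _ x)) ⟩
  falling g (suc k) * x + b * falling g k * x
    ≡⟨ sym (*-distribʳ-+ x (falling g (suc k)) (b * falling g k)) ⟩
  (falling g (suc k) + b * falling g k) * x
    ≡⟨ cong (_* x) (cong₂ _+_ (falling-sucʳ g k) (*-comm b (falling g k))) ⟩
  (falling g k * (g ∸ k) + falling g k * b) * x
    ≡⟨ cong (_* x) (sym (*-distribˡ-+ (falling g k) (g ∸ k) b)) ⟩
  falling g k * (g ∸ k + b) * x
    ≡⟨ cong (_* x) (falling-*-∸-+ g b k) ⟩
  falling g k * (g + b ∸ k) * x
    ≡⟨ *-assoc (falling g k) (g + b ∸ k) x ⟩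
  falling g k * ((g + b ∸ k) * x) ∎
  where open ≡-Reasoning

pred-∸ : ∀ c k → pred c ∸ k ≡ pred (c ∸ k)
pred-∸ c k = trans (∸-+-assoc c 1 k) (sym (pred[m∸n]≡m∸[1+n] c k))

∑-falling : ∀ k M → suc k * ∑[ a < M ] falling (M ∸ suc (toℕ a)) k ≡ falling M (suc k)
∑-falling k zero    = *-zeroʳ (suc k)
∑-falling k (suc M) = begin
  suc k * (falling M k + ∑[ a < M ] falling (M ∸ suc (toℕ a)) k)
    ≡⟨ *-distribˡ-+ (suc k) (falling M k) _ ⟩
  suc k * falling M k + suc k * ∑[ a < M ] falling (M ∸ suc (toℕ a)) k
    ≡⟨ cong (suc k * falling M k +_) (trans (∑-falling k M) (falling-sucʳ M k)) ⟩
  suc k * falling M k + falling M k * (M ∸ k)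
    ≡⟨ +-comm (suc k * falling M k) _ ⟩
  falling M k * (M ∸ k) + suc k * falling M k
    ≡⟨ cong (falling M k * (M ∸ k) +_) (*-comm (suc k) (falling M k)) ⟩
  falling M k * (M ∸ k) + falling M k * suc k
    ≡⟨ sym (*-distribˡ-+ (falling M k) (M ∸ k) (suc k)) ⟩
  falling M k * (M ∸ k + suc k)
    ≡⟨ falling-*-∸-+ M (suc k) k ⟩
  falling M k * (M + suc k ∸ k)
    ≡⟨ cong (λ c → falling M k * (c ∸ k)) (+-suc M k) ⟩
  falling M k * (suc M + k ∸ k)
    ≡⟨ cong (falling M k *_) (m+n∸n≡m (suc M) k) ⟩
  falling M k * suc M
    ≡⟨ *-comm (falling M k) (suc M) ⟩
  suc M * falling M k ∎
  where open ≡-Reasoning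

-- Injective words

count-allVecs : ∀ n m (P : Vec (Fin n) (suc m) → Bool) →
                count P (allVecs n (suc m)) ≡ ∑[ a < n ] count (P ∘ (a ∷_)) (allVecs n m)
count-allVecs n m P = begin
  count P (concatMap (λ a → map (a ∷_) (allVecs n m)) (allFin n))
    ≡⟨ count-concatMap P _ (allFin n) ⟩
  sum (map (λ a → count P (map (a ∷_) (allVecs n m))) (tabulate (λ a → a)))
    ≡⟨ cong sum (map-tabulate {n = n} (λ a → a) (λ a → count P (map (a ∷_) (allVecs n m)))) ⟩
  sum (tabulate (λ a → count P (map (a ∷_) (allVecs n m))))
    ≡⟨ sum-tabulate {n} _ ⟩
  ∑[ a < n ] count P (map (a ∷_) (allVecs n m))
    ≡⟨ sum-cong-≗ {n} (λ a → count-map P (a ∷_) (allVecs n m)) ⟩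
  ∑[ a < n ] count (P ∘ (a ∷_)) (allVecs n m) ∎
  where open ≡-Reasoning

Distinct : ∀ {A : Set} {m} → Vec A m → Set
Distinct w = Injective _≡_ _≡_ (lookup w)

distinct-[] : ∀ {A : Set} → Distinct {A} []
distinct-[] {x = ()}

distinct-∷⁻ : ∀ {A : Set} {m} {a : A} {w : Vec A m} →
              Distinct (a ∷ w) → Distinct w × (∀ y → lookup w y ≢ a)
distinct-∷⁻ inj = Fin-suc-injective ∘ inj , λ y wy≡a → case inj {Fin.suc y} {Fin.zero} wy≡a of λ ()

distinct-∷⁺ : ∀ {A : Set} {m} {a : A} {w : Vec A m} →
              Distinct w → (∀ y → lookup w y ≢ a) → Distinct (a ∷ w)
distinct-∷⁺ inj a∉w {Fin.zero}  {Fin.zero}  _ = refl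
distinct-∷⁺ inj a∉w {Fin.zero}  {Fin.suc y} e = ⊥-elim (a∉w y (sym e))
distinct-∷⁺ inj a∉w {Fin.suc x} {Fin.zero}  e = ⊥-elim (a∉w x e)
distinct-∷⁺ inj a∉w {Fin.suc x} {Fin.suc y} e = cong Fin.suc (inj e)

injectiveIn : ∀ {n m} → (Fin n → Bool) → Vec (Fin n) m → Bool
injectiveIn S []      = true
injectiveIn S (x ∷ w) = S x ∧ injectiveIn (S ∖ x) w

count-injectiveIn : ∀ {n} m (S : Fin n → Bool) → count (injectiveIn S) (allVecs n m) ≡ falling (card S) m
count-injectiveIn         zero    S = refl
count-injectiveIn {n} (suc m) S = begin
  count (injectiveIn S) (allVecs n (suc m))
    ≡⟨ count-allVecs n m (injectiveIn S) ⟩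
  ∑[ a < n ] count (λ w → S a ∧ injectiveIn (S ∖ a) w) (allVecs n m)
    ≡⟨ sum-cong-≗ {n} (λ a → count-const-∧ (S a) (injectiveIn (S ∖ a)) (allVecs n m)) ⟩
  ∑[ a < n ] (𝟙 (S a) * count (injectiveIn (S ∖ a)) (allVecs n m))
    ≡⟨ sum-cong-≗ {n} (λ a → cong (𝟙 (S a) *_) (count-injectiveIn m (S ∖ a))) ⟩
  ∑[ a < n ] (𝟙 (S a) * falling (card (S ∖ a)) m)
    ≡⟨ sum-cong-≗ {n} (𝟙-*-card-∖ (λ c → falling c m) S) ⟩
  ∑[ a < n ] (𝟙 (S a) * falling (pred (card S)) m)
    ≡⟨ sym (*-distribʳ-sum (falling (pred (card S)) m) (𝟙 ∘ S)) ⟩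
  card S * falling (pred (card S)) m ∎
  where open ≡-Reasoning

record InjectiveIn {n m} (S : Fin n → Bool) (w : Vec (Fin n) m) : Set where
  constructor _,_
  field
    distinct : Distinct w
    within   : ∀ x → T (S (lookup w x))

module _ {n m} {S : Fin n → Bool} {a : Fin n} {w : Vec (Fin n) m} where

  injectiveIn-∷⁻ : InjectiveIn S (a ∷ w) → T (S a) × InjectiveIn (S ∖ a) w
  injectiveIn-∷⁻ (inj , inS) = let inj′ , a∉w = distinct-∷⁻ inj in
    inS Fin.zero , inj′ , λ y → T-∖⁺ {S = S} (inS (Fin.suc y)) (a∉w y)

  injectiveIn-∷⁺ : T (S a) → InjectiveIn (S ∖ a) w → InjectiveIn S (a ∷ w)
  injectiveIn-∷⁺ Sa (inj , inS∖a) =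
    distinct-∷⁺ inj (λ y → proj₂ (T-∖⁻ {S = S} (inS∖a y))) ,
    λ { Fin.zero → Sa ; (Fin.suc y) → proj₁ (T-∖⁻ {S = S} (inS∖a y)) }

injectiveIn⁻ : ∀ {n m} (S : Fin n → Bool) (w : Vec (Fin n) m) → T (injectiveIn S w) → InjectiveIn S w
injectiveIn⁻ S []      _ = distinct-[] , λ ()
injectiveIn⁻ S (a ∷ w) h = let Sa , h′ = to T-∧ h in injectiveIn-∷⁺ Sa (injectiveIn⁻ (S ∖ a) w h′)

injectiveIn⁺ : ∀ {n m} (S : Fin n → Bool) (w : Vec (Fin n) m) → InjectiveIn S w → T (injectiveIn S w)
injectiveIn⁺ S []      _ = _
injectiveIn⁺ S (a ∷ w) i = let Sa , i′ = injectiveIn-∷⁻ i in from T-∧ (Sa , injectiveIn⁺ (S ∖ a) w i′)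

injectiveIn-∩⁻ : ∀ {n m} {S G : Fin n → Bool} {w : Vec (Fin n) m} →
                 InjectiveIn (S ∩ G) w → InjectiveIn S w × (∀ x → T (G (lookup w x)))
injectiveIn-∩⁻ (inj , inS∩G) = (inj , proj₁ ∘ to T-∧ ∘ inS∩G) , proj₂ ∘ to T-∧ ∘ inS∩G

injectiveIn-∩⁺ : ∀ {n m} {S G : Fin n → Bool} {w : Vec (Fin n) m} →
                 InjectiveIn S w → (∀ x → T (G (lookup w x))) → InjectiveIn (S ∩ G) w
injectiveIn-∩⁺ (inj , inS) inG = inj , λ x → from T-∧ (inS x , inG x)

module WordsWithTop {n} (top : Fin n) (G : Fin n → Bool) where

  topAt : ∀ {m} → ℕ → (Fin n → Bool) → Vec (Fin n) m → Bool
  topAt r       S []      = false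
  topAt zero    S (x ∷ w) = (x == top) ∧ (S x ∧ injectiveIn (S ∖ x ∩ G) w)
  topAt (suc r) S (x ∷ w) = S x ∧ topAt r (S ∖ x) w

  TopAt : ∀ {m} → ℕ → Vec (Fin n) m → Set
  TopAt {m} r w = ∃ λ (p : Fin m) →
    toℕ p ≡ r × lookup w p ≡ top × (∀ x → r < toℕ x → T (G (lookup w x)))

  topAt⁻ : ∀ {m} r S (w : Vec (Fin n) m) → T (topAt r S w) → InjectiveIn S w × TopAt r w
  topAt⁻ zero S (a ∷ w) h =
    let a≡top , h′ = to T-∧ h
        Sa , h″ = to T-∧ h′
        injS∖a , inG = injectiveIn-∩⁻ (injectiveIn⁻ (S ∖ a ∩ G) w h″)
    in injectiveIn-∷⁺ Sa injS∖a ,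
       (Fin.zero , refl , to T-== a≡top , λ { (Fin.suc y) _ → inG y })
  topAt⁻ (suc r) S (a ∷ w) h =
    let Sa , h′ = to T-∧ h
        injS∖a , (p , p≡r , w[p]≡top , after) = topAt⁻ r (S ∖ a) w h′
    in injectiveIn-∷⁺ Sa injS∖a ,
       (Fin.suc p , cong suc p≡r , w[p]≡top , λ { (Fin.suc y) (s≤s r<y) → after y r<y })

  topAt⁺ : ∀ {m} r S (w : Vec (Fin n) m) → InjectiveIn S w → TopAt r w → T (topAt r S w)
  topAt⁺ zero S (a ∷ w) injS (Fin.zero , _ , a≡top , after) =
    let Sa , injS∖a = injectiveIn-∷⁻ injS
    in from T-∧ (from T-== a≡top , from T-∧ (Sa ,
         injectiveIn⁺ (S ∖ a ∩ G) w (injectiveIn-∩⁺ injS∖a (λ y → after (Fin.suc y) z<s))))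
  topAt⁺ (suc r) S (a ∷ w) injS (Fin.suc p , 1+p≡1+r , w[p]≡top , after) =
    let Sa , injS∖a = injectiveIn-∷⁻ injS
    in from T-∧ (Sa , topAt⁺ r (S ∖ a) w injS∖a
         (p , suc-injective 1+p≡1+r , w[p]≡top , λ y r<y → after (Fin.suc y) (s≤s r<y)))

  -- The K letters after top are drawn from G, then the r letters before it from what remains.
  count-topAt : ∀ r K S → count (topAt r S) (allVecs n (suc (r + K)))
                ≡ 𝟙 (S top) * (falling (card (S ∖ top ∩ G)) K * falling (card (S ∖ top) ∸ K) r)
  count-topAt zero K S = begin
    count (topAt zero S) (allVecs n (suc K))
      ≡⟨ count-allVecs n K (topAt zero S) ⟩
    ∑[ a < n ] count (λ w → (a == top) ∧ (S a ∧ injectiveIn (S ∖ a ∩ G) w)) (allVecs n K)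
      ≡⟨ sum-cong-≗ {n} first-letter ⟩
    ∑[ a < n ] (𝟙 (a == top) * (𝟙 (S a) * falling (card (S ∖ a ∩ G)) K))
      ≡⟨ ∑-𝟙-== (λ a → 𝟙 (S a) * falling (card (S ∖ a ∩ G)) K) top ⟩
    𝟙 (S top) * falling (card (S ∖ top ∩ G)) K
      ≡⟨ cong (𝟙 (S top) *_) (sym (*-identityʳ _)) ⟩
    𝟙 (S top) * (falling (card (S ∖ top ∩ G)) K * 1) ∎
    where
    open ≡-Reasoning
    first-letter : ∀ a → count (λ w → (a == top) ∧ (S a ∧ injectiveIn (S ∖ a ∩ G) w)) (allVecs n K)
                         ≡ 𝟙 (a == top) * (𝟙 (S a) * falling (card (S ∖ a ∩ G)) K)
    first-letter a = trans (count-const-∧ (a == top) _ (allVecs n K)) (cong (𝟙 (a == top) *_)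
      (trans (count-const-∧ (S a) _ (allVecs n K)) (cong (𝟙 (S a) *_) (count-injectiveIn K (S ∖ a ∩ G)))))
  count-topAt (suc r) K S = begin
    count (topAt (suc r) S) (allVecs n (suc (suc r + K)))
      ≡⟨ count-allVecs n (suc (r + K)) (topAt (suc r) S) ⟩
    ∑[ a < n ] count (λ w → S a ∧ topAt r (S ∖ a) w) (allVecs n (suc (r + K)))
      ≡⟨ sum-cong-≗ {n} (λ a → trans (count-const-∧ (S a) _ (allVecs n (suc (r + K))))
                                       (cong (𝟙 (S a) *_) (count-topAt r K (S ∖ a)))) ⟩
    ∑[ a < n ] (𝟙 (S a) * (𝟙 ((S ∖ a) top) * Φ (card (S ∖ a ∖ top ∩ G)) (card (S ∖ a ∖ top))))
      ≡⟨ sum-cong-≗ {n} (𝟙-*-card-∖-∖ Φ S G top) ⟩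
    ∑[ a < n ] (𝟙 (S top) * (𝟙 ((S′ ∩ G) a) * Φ (pred g) (pred c) + 𝟙 ((S′ ∩ ∁ G) a) * Φ g (pred c)))
      ≡⟨ ∑-𝟙-*-+ (S′ ∩ G) (S′ ∩ ∁ G) (𝟙 (S top)) (Φ (pred g) (pred c)) (Φ g (pred c)) ⟩
    𝟙 (S top) * (g * Φ (pred g) (pred c) + b * Φ g (pred c))
      ≡⟨ cong (𝟙 (S top) *_) (falling-step g b K (falling (pred c ∸ K) r)) ⟩
    𝟙 (S top) * (falling g K * ((g + b ∸ K) * falling (pred c ∸ K) r))
      ≡⟨ cong (λ z → 𝟙 (S top) * (falling g K * z))
              (cong₂ (λ d e → (d ∸ K) * falling e r) (card-∩-∁ S′ G) (pred-∸ c K)) ⟩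
    𝟙 (S top) * (falling g K * falling (c ∸ K) (suc r)) ∎
    where
    open ≡-Reasoning
    Φ : ℕ → ℕ → ℕ
    Φ g′ c′ = falling g′ K * falling (c′ ∸ K) r
    S′ : Fin n → Bool
    S′ = S ∖ top
    g b c : ℕ
    g = card (S′ ∩ G)
    b = card (S′ ∩ ∁ G)
    c = card S′

-- Containment of the pattern

module Containment {m} (v : Vec (Fin (suc m)) (suc m)) where

  posLine valLine : Fin (suc m) → Fin (suc m) → Fin 4 → ℕ
  posLine i j = line (suc m) (pos i) (pos j)
  valLine i j = line (suc m) (val v i) (val v j)

  BoxEmpty : Fin (suc m) → Fin (suc m) → Fin 3 × Fin 3 → Set
  BoxEmpty i j (a , b) = ∀ x →
    posLine i j (Fin.inject₁ a) < pos x → pos x < posLine i j (Fin.suc a) →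
    valLine i j (Fin.inject₁ b) < val v x → val v x < valLine i j (Fin.suc b) → ⊥

  inBox : Fin (suc m) → Fin (suc m) → Fin 3 × Fin 3 → Fin (suc m) → Bool
  inBox i j (a , b) x =
    (posLine i j (Fin.inject₁ a) <ᵇ pos x) ∧ (pos x <ᵇ posLine i j (Fin.suc a)) ∧
    (valLine i j (Fin.inject₁ b) <ᵇ val v x) ∧ (val v x <ᵇ valLine i j (Fin.suc b))

  boxEmpty⁻ : ∀ i j ab → T (boxEmpty v i j ab) → BoxEmpty i j ab
  boxEmpty⁻ i j ab h x l₁ l₂ l₃ l₄ = to T-not h (any-allFin⁺ (inBox i j ab) x
    (from T-∧ (from T-<ᵇ l₁ , from T-∧ (from T-<ᵇ l₂ , from T-∧ (from T-<ᵇ l₃ , from T-<ᵇ l₄)))))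

  boxEmpty⁺ : ∀ i j ab → BoxEmpty i j ab → T (boxEmpty v i j ab)
  boxEmpty⁺ i j ab e = from T-not λ h →
    let x , c = any-allFin⁻ (inBox i j ab) h
        c₁ , c′ = to T-∧ c
        c₂ , c″ = to T-∧ c′
        c₃ , c₄ = to T-∧ c″
    in e x (to T-<ᵇ c₁) (to T-<ᵇ c₂) (to T-<ᵇ c₃) (to T-<ᵇ c₄)

  occurs : Fin (suc m) → Fin (suc m) → Bool
  occurs i j = (pos i <ᵇ pos j) ∧ (val v i <ᵇ val v j) ∧ all (boxEmpty v i j) Rp

  Occurrence : Fin (suc m) → Fin (suc m) → Set
  Occurrence i j = pos i < pos j × val v i < val v j × All (BoxEmpty i j) Rp

  contains⁻ : T (contains12 Rp v) → ∃₂ Occurrence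
  contains⁻ h =
    let i , h₁ = any-allFin⁻ (λ i → any (occurs i) (allFin _)) h
        j , h₂ = any-allFin⁻ (occurs i) h₁
        c₁ , h₃ = to T-∧ h₂
        c₂ , c₃ = to T-∧ h₃
    in i , j , to T-<ᵇ c₁ , to T-<ᵇ c₂ , All.map (boxEmpty⁻ i j _) (all⁺ (boxEmpty v i j) Rp c₃)

  contains⁺ : ∀ {i j} → Occurrence i j → T (contains12 Rp v)
  contains⁺ {i} {j} (c₁ , c₂ , c₃) =
    any-allFin⁺ (λ i → any (occurs i) (allFin _)) i (any-allFin⁺ (occurs i) j (from T-∧ (from T-<ᵇ c₁ ,
      from T-∧ (from T-<ᵇ c₂ , all⁻ (boxEmpty v i j) (All.map (boxEmpty⁺ i j _) c₃)))))

  ContainsShape : Fin (suc m) → Set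
  ContainsShape p = 0 < toℕ p × (∀ x → toℕ p < toℕ x → toℕ (lookup v Fin.zero) < toℕ (lookup v x))

  module _ (inj : Distinct v) {p : Fin (suc m)} (p-max : toℕ (lookup v p) ≡ m) where

    private
      pos-injective : ∀ {x y : Fin (suc m)} → pos x ≡ pos y → x ≡ y
      pos-injective = toℕ-injective ∘ suc-injective

      val-injective : ∀ {x y} → val v x ≡ val v y → x ≡ y
      val-injective = inj ∘ toℕ-injective ∘ suc-injective

      pos<2+m : ∀ x → pos x < suc (suc m)
      pos<2+m x = s≤s (toℕ<n x)

      val<2+m : ∀ x → val v x < suc (suc m)
      val<2+m x = s≤s (toℕ<n (lookup v x))

      below-max : ∀ {x} → x ≢ p → toℕ (lookup v x) < m
      below-max {x} x≢p =
        ≤∧≢⇒< (s≤s⁻¹ (toℕ<n (lookup v x))) (λ e → x≢p (inj (toℕ-injective (trans e (sym p-max)))))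

    occurrence-max : ∀ {i j} → Occurrence i j → ∀ x → ¬ val v j < val v x
    occurrence-max {i} {j} (_ , vi<vj , _ ∷ _ ∷ e₀₂ ∷ e₁₂ ∷ _ ∷ e₂₂ ∷ []) x vj<vx
      with <-cmp (pos x) (pos i)
    ... | tri< px<pi _ _ = e₀₂ x z<s px<pi vj<vx (val<2+m x)
    ... | tri≈ _ px≡pi _ = <-asym vi<vj (subst (λ y → val v j < val v y) (pos-injective px≡pi) vj<vx)
    ... | tri> _ _ pi<px with <-cmp (pos x) (pos j)
    ...   | tri< px<pj _ _ = e₁₂ x pi<px px<pj vj<vx (val<2+m x)
    ...   | tri≈ _ px≡pj _ = <-irrefl (cong (val v) (sym (pos-injective px≡pj))) vj<vx
    ...   | tri> _ _ pj<px = e₂₂ x pj<px (pos<2+m x) vj<vx (val<2+m x)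

    occurrence-ends-at-max : ∀ {i j} → Occurrence i j → j ≡ p
    occurrence-ends-at-max {j = j} occ with j ≟ᶠ p
    ... | yes j≡p = j≡p
    ... | no  j≢p = ⊥-elim (occurrence-max occ p (s≤s (subst (_ <_) (sym p-max) (below-max j≢p))))

    occurrence-starts-first : ∀ {i j} → Occurrence i j → i ≡ Fin.zero
    occurrence-starts-first {Fin.zero}  _ = refl
    occurrence-starts-first {Fin.suc i} {j} occ@(pi<pj , _ , e₀₀ ∷ e₀₁ ∷ _)
      with <-cmp (val v Fin.zero) (val v (Fin.suc i))
    ... | tri< v0<vi _ _ = ⊥-elim (e₀₀ Fin.zero z<s (s≤s (s≤s z≤n)) z<s v0<vi)
    ... | tri≈ _ v0≡vi _ = case val-injective v0≡vi of λ ()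
    ... | tri> _ _ vi<v0 with <-cmp (val v Fin.zero) (val v j)
    ...   | tri< v0<vj _ _ = ⊥-elim (e₀₁ Fin.zero z<s (s≤s (s≤s z≤n)) vi<v0 v0<vj)
    ...   | tri≈ _ v0≡vj _ =
      case subst (λ y → pos (Fin.suc i) < pos y) (sym (val-injective v0≡vj)) pi<pj of λ { (s≤s ()) }
    ...   | tri> _ _ vj<v0 = ⊥-elim (occurrence-max occ Fin.zero vj<v0)

    occurrence⇒shape : ∀ {i j} → Occurrence i j → ContainsShape p
    occurrence⇒shape occ with occurrence-starts-first occ | occurrence-ends-at-max occ
    occurrence⇒shape occ@(p0<pp , _ , _ ∷ _ ∷ _ ∷ _ ∷ e₂₀ ∷ _) | refl | refl = s≤s⁻¹ p0<pp , right
      where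
      right : ∀ x → toℕ p < toℕ x → toℕ (lookup v Fin.zero) < toℕ (lookup v x)
      right x p<x with <-cmp (toℕ (lookup v Fin.zero)) (toℕ (lookup v x))
      ... | tri< t0<tx _ _ = t0<tx
      ... | tri≈ _ t0≡tx _ = case subst (λ y → toℕ p < toℕ y) (sym (inj (toℕ-injective t0≡tx))) p<x of λ ()
      ... | tri> _ _ tx<t0 = ⊥-elim (e₂₀ x (s≤s p<x) (pos<2+m x) z<s (s≤s tx<t0))

    shape⇒occurrence : ContainsShape p → Occurrence Fin.zero p
    shape⇒occurrence (0<p , right) =
      s≤s 0<p , s≤s (subst (_ <_) (sym p-max) (below-max zero≢p)) ,
      left-empty {f0} ∷ left-empty {f1} ∷ left-empty {f2} ∷
      nothing-above-max {f1} ∷ right-empty ∷ nothing-above-max {f2} ∷ []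
      where
      zero≢p : Fin.zero ≢ p
      zero≢p 0≡p = <-irrefl (cong toℕ 0≡p) 0<p
      left-empty : ∀ {b} → BoxEmpty Fin.zero p (f0 , b)
      left-empty x _ (s≤s ())
      nothing-above-max : ∀ {a} → BoxEmpty Fin.zero p (a , f2)
      nothing-above-max x _ _ vp<vx _ = ≤⇒≯ (toℕ<n (lookup v x)) (subst (λ z → suc z < val v x) p-max vp<vx)
      right-empty : BoxEmpty Fin.zero p (f2 , f0)
      right-empty x p<x _ _ vx<v0 = <-asym (right x (s≤s⁻¹ p<x)) (s≤s⁻¹ vx<v0)

    contains⇔shape : T (contains12 Rp v) ⇔ ContainsShape p
    contains⇔shape =
      mk⇔ (λ h → occurrence⇒shape (proj₂ (proj₂ (contains⁻ h)))) (contains⁺ ∘ shape⇒occurrence)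

-- Permutations

distinct⁻ : ∀ {n} (v : Vec (Fin n) n) → T (distinctB v) → Distinct v
distinct⁻ {n} v h {x} {y} vx≡vy
  with toℕ x ≟ toℕ y | lookup v x ≟ᶠ lookup v y
     | All.lookup (all⁺ _ (allFin n) (All.lookup (all⁺ _ (allFin n) h) (∈-allFin x))) (∈-allFin y)
... | yes x≡y | _        | _ = toℕ-injective x≡y
... | no _    | no vx≢vy | _ = ⊥-elim (vx≢vy vx≡vy)

distinct⁺ : ∀ {n} (v : Vec (Fin n) n) → Distinct v → T (distinctB v)
distinct⁺ {n} v inj with T? (distinctB v)
... | yes h  = h
... | no ¬h with satisfied (¬All⇒Any¬ (T? ∘ _) (allFin n) (¬h ∘ all⁻ _))
...   | x , ¬hx with satisfied (¬All⇒Any¬ (T? ∘ _) (allFin n) (¬hx ∘ all⁻ _))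
...     | y , ¬hxy with toℕ x ≟ toℕ y | lookup v x ≟ᶠ lookup v y
...       | yes _   | _        = ⊥-elim (¬hxy _)
...       | no _    | no _     = ⊥-elim (¬hxy _)
...       | no x≢y  | yes vx≡vy = ⊥-elim (x≢y (cong toℕ (inj vx≡vy)))

distinct⇒max : ∀ {m} (v : Vec (Fin (suc m)) (suc m)) → Distinct v → ∃ λ p → toℕ (lookup v p) ≡ m
distinct⇒max {m} v inj with any? (λ x → lookup v x ≟ᶠ Fin.fromℕ m)
... | yes (p , vp≡m) = p , trans (cong toℕ vp≡m) (toℕ-fromℕ m)
... | no  ∄p with pigeonhole (n<1+n m) (λ x → Fin.lower₁ (lookup v x) (m≢ x))
  where
  m≢ : ∀ x → m ≢ toℕ (lookup v x)
  m≢ x m≡vx = ∄p (x , toℕ-injective (trans (sym m≡vx) (sym (toℕ-fromℕ m))))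
...   | i , j , i<j , same = ⊥-elim (<-irrefl (cong toℕ (inj (lower₁-injective same))) i<j)

nAtRight⇔ : ∀ {m} (v : Vec (Fin (suc m)) (suc m)) → Distinct v → ∀ {p} → toℕ (lookup v p) ≡ m →
            ∀ i → T (nAtRight i v) ⇔ toℕ p ≡ suc m ∸ i
nAtRight⇔ {m} v inj {p} p-max i = mk⇔ at-p λ p≡ →
  any-allFin⁺ nAt p (from T-∧ (from T-≟ (trans (cong suc p≡) (+-comm 1 _)) , from T-≟ (cong suc p-max)))
  where
  nAt : Fin (suc m) → Bool
  nAt x = ⌊ pos x ≟ (suc m ∸ i) + 1 ⌋ ∧ ⌊ val v x ≟ suc m ⌋
  at-p : T (nAtRight i v) → toℕ p ≡ suc m ∸ i
  at-p h = let x , hx = any-allFin⁻ nAt h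
               pos≡ , val≡ = to T-∧ hx
               x≡p = inj (toℕ-injective (trans (suc-injective (to T-≟ val≡)) (sym p-max)))
           in subst (λ y → toℕ y ≡ suc m ∸ i) x≡p (suc-injective (trans (to T-≟ pos≡) (+-comm _ 1)))

countSn≡count : ∀ n t → countSn n t ≡ count (λ v → distinctB v ∧ t v) (allVecs n n)
countSn≡count n t = trans (length-filter t (Sn n)) (count-filter t distinctB (allVecs n n))

count-distinct : ∀ n → count distinctB (allVecs n n) ≡ n !
count-distinct n = begin
  count distinctB (allVecs n n)               ≡⟨ count-cong distinct≡injective (allVecs n n) ⟩
  count (injectiveIn full) (allVecs n n)      ≡⟨ count-injectiveIn n full ⟩
  falling (card full) n                       ≡⟨ cong (λ c → falling c n) (card-all n) ⟩
  falling n n                                 ≡⟨ falling-self n ⟩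
  n !                                         ∎
  where
  open ≡-Reasoning
  full : Fin n → Bool
  full _ = true
  distinct≡injective : ∀ v → distinctB v ≡ injectiveIn full v
  distinct≡injective v = T-⇔⇒≡ (mk⇔
    (λ h → injectiveIn⁺ full v (distinct⁻ v h , λ _ → _))
    (λ h → distinct⁺ v (InjectiveIn.distinct (injectiveIn⁻ full v h))))

-- Permutations of length r + K + 2 with the maximum at position r + 2, i.e. K + 1 from the right.
module MaxAtPosition (r K : ℕ) where

  m : ℕ
  m = suc (r + K)

  top : Fin (suc m)
  top = Fin.fromℕ m

  full : Fin (suc m) → Bool
  full _ = true

  above : Fin (suc m) → Fin (suc m) → Bool
  above a y = toℕ a <ᵇ toℕ y

  shapeᵇ : Vec (Fin (suc m)) (suc m) → Bool
  shapeᵇ (a ∷ w) = WordsWithTop.topAt top (above a) r (full ∖ a) w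

  count-shapeᵇ-from : ∀ a → toℕ a < m →
    count (WordsWithTop.topAt top (above a) r (full ∖ a)) (allVecs (suc m) m) ≡ falling (m ∸ suc (toℕ a)) K * r !
  count-shapeᵇ-from a a<m = begin
    count (topAt r (full ∖ a)) (allVecs (suc m) m)
      ≡⟨ count-topAt r K (full ∖ a) ⟩
    𝟙 ((full ∖ a) top) * (falling (card (full ∖ a ∖ top ∩ above a)) K * falling (card (full ∖ a ∖ top) ∸ K) r)
      ≡⟨ cong₂ (λ s d → 𝟙 s * (falling d K * falling (card (full ∖ a ∖ top) ∸ K) r)) a-keeps-top larger ⟩
    1 * (falling (m ∸ suc (toℕ a)) K * falling (card (full ∖ a ∖ top) ∸ K) r)
      ≡⟨ *-identityˡ _ ⟩
    falling (m ∸ suc (toℕ a)) K * falling (card (full ∖ a ∖ top) ∸ K) r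
      ≡⟨ cong (λ c → falling (m ∸ suc (toℕ a)) K * falling (c ∸ K) r) rest ⟩
    falling (m ∸ suc (toℕ a)) K * falling (r + K ∸ K) r
      ≡⟨ cong (falling (m ∸ suc (toℕ a)) K *_) (trans (cong (λ c → falling c r) (m+n∸n≡m r K)) (falling-self r)) ⟩
    falling (m ∸ suc (toℕ a)) K * r ! ∎
    where
    open ≡-Reasoning
    open WordsWithTop top (above a)
    top≢a : top ≢ a
    top≢a top≡a = <-irrefl (trans (cong toℕ (sym top≡a)) (toℕ-fromℕ m)) a<m
    a-keeps-top : (full ∖ a) top ≡ true
    a-keeps-top = cong not (==-≢ top≢a)
    a<top : above a top ≡ true
    a<top = to T-≡ (from T-<ᵇ (subst (toℕ a <_) (sym (toℕ-fromℕ m)) a<m))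
    rest : card (full ∖ a ∖ top) ≡ r + K
    rest = suc-injective (suc-injective (begin
      suc (suc (card (full ∖ a ∖ top))) ≡⟨ cong suc (card-∖ (full ∖ a) top a-keeps-top) ⟨
      suc (card (full ∖ a))             ≡⟨ card-∖ full a refl ⟨
      card full                         ≡⟨ card-all (suc m) ⟩
      suc m                             ∎))
    larger : card (full ∖ a ∖ top ∩ above a) ≡ m ∸ suc (toℕ a)
    larger = begin
      card (full ∖ a ∖ top ∩ above a)  ≡⟨ card-cong above-a-avoids-a ⟩
      card (above a ∖ top)             ≡⟨ cong pred (card-∖ (above a) top a<top) ⟨
      pred (card (above a))            ≡⟨ cong pred (card-> (suc m) (toℕ a)) ⟩
      pred (m ∸ toℕ a)                 ≡⟨ pred[m∸n]≡m∸[1+n] m (toℕ a) ⟩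
      m ∸ suc (toℕ a)                  ∎
      where
      above-a-avoids-a : ∀ y → (full ∖ a ∖ top ∩ above a) y ≡ (above a ∖ top) y
      above-a-avoids-a y with y ≟ᶠ a
      ... | yes refl rewrite <ᵇ-irrefl (toℕ y) = refl
      ... | no _     = ∧-comm (not (y == top)) (above a y)

  count-shapeᵇ-from-top : count (WordsWithTop.topAt top (above top) r (full ∖ top)) (allVecs (suc m) m) ≡ 0
  count-shapeᵇ-from-top = trans (WordsWithTop.count-topAt top (above top) r K (full ∖ top))
                          (cong (λ b → 𝟙 (not b) * (falling (card (full ∖ top ∖ top ∩ above top)) K
                                                        * falling (card (full ∖ top ∖ top) ∸ K) r)) (==-refl top))

  factorial-split : m ! ≡ (∑[ a < m ] falling (m ∸ suc (toℕ a)) K) * r ! * suc K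
  factorial-split = begin
    m !                                 ≡⟨ cong (λ c → suc c !) (+-comm r K) ⟩
    (suc K + r) !                       ≡⟨ falling-*-! (suc K) r ⟨
    falling (suc K + r) (suc K) * r !   ≡⟨ cong (λ c → falling (suc c) (suc K) * r !) (+-comm K r) ⟩
    falling m (suc K) * r !             ≡⟨ cong (_* r !) (∑-falling K m) ⟨
    suc K * Σ * r !                     ≡⟨ cong (_* r !) (*-comm (suc K) Σ) ⟩
    Σ * suc K * r !                     ≡⟨ *-assoc Σ (suc K) (r !) ⟩
    Σ * (suc K * r !)                   ≡⟨ cong (Σ *_) (*-comm (suc K) (r !)) ⟩
    Σ * (r ! * suc K)                   ≡⟨ *-assoc Σ (r !) (suc K) ⟨
    Σ * r ! * suc K                     ∎
    where
    open ≡-Reasoning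
    Σ : ℕ
    Σ = ∑[ a < m ] falling (m ∸ suc (toℕ a)) K

  count-shapeᵇ : count shapeᵇ (allVecs (suc m) (suc m)) ≡ m ! / suc K
  count-shapeᵇ = begin
    count shapeᵇ (allVecs (suc m) (suc m))
      ≡⟨ count-allVecs (suc m) m shapeᵇ ⟩
    ∑[ a < suc m ] N a
      ≡⟨ sum-init-last N ⟩
    ∑[ a < m ] N (Fin.inject₁ a) + N top
      ≡⟨ cong₂ _+_ (sum-cong-≗ {m} first-below-top) count-shapeᵇ-from-top ⟩
    ∑[ a < m ] (falling (m ∸ suc (toℕ a)) K * r !) + 0
      ≡⟨ +-identityʳ _ ⟩
    ∑[ a < m ] (falling (m ∸ suc (toℕ a)) K * r !)
      ≡⟨ *-distribʳ-sum {m} (r !) (λ a → falling (m ∸ suc (toℕ a)) K) ⟨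
    (∑[ a < m ] falling (m ∸ suc (toℕ a)) K) * r !
      ≡⟨ m*n/n≡m _ (suc K) ⟨
    (∑[ a < m ] falling (m ∸ suc (toℕ a)) K) * r ! * suc K / suc K
      ≡⟨ cong (_/ suc K) factorial-split ⟨
    m ! / suc K ∎
    where
    open ≡-Reasoning
    N : Fin (suc m) → ℕ
    N a = count (WordsWithTop.topAt top (above a) r (full ∖ a)) (allVecs (suc m) m)
    first-below-top : ∀ a → N (Fin.inject₁ a) ≡ falling (m ∸ suc (toℕ a)) K * r !
    first-below-top a = trans (count-shapeᵇ-from (Fin.inject₁ a) (subst (_< m) (sym (toℕ-inject₁ a)) (toℕ<n a)))
                              (cong (λ i → falling (m ∸ suc i) K * r !) (toℕ-inject₁ a))

  shapeᵇ-spec : ∀ v → distinctB v ∧ (nAtRight (suc K) v ∧ contains12 Rp v) ≡ shapeᵇ v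
  shapeᵇ-spec v@(a ∷ w) = T-⇔⇒≡ (mk⇔ shaped unshaped)
    where
    open WordsWithTop top (above a)
    open Containment v

    max-position : suc m ∸ suc K ≡ suc r
    max-position = m+n∸n≡m (suc r) K

    rest-avoids-first : Distinct v → InjectiveIn (full ∖ a) w
    rest-avoids-first inj = let inj′ , a∉w = distinct-∷⁻ inj in inj′ , λ x → T-∖⁺ {S = full} _ (a∉w x)

    top-after-first : ∀ p → toℕ (lookup v p) ≡ m → toℕ p ≡ suc r → ContainsShape p → TopAt r w
    top-after-first (Fin.suc p) p-max p≡1+r (_ , right) =
      p , suc-injective p≡1+r , toℕ-injective (trans p-max (sym (toℕ-fromℕ m))) ,
      λ x r<x → from T-<ᵇ (right (Fin.suc x) (subst (_< suc (toℕ x)) (sym p≡1+r) (s≤s r<x)))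

    shaped : T (distinctB v ∧ (nAtRight (suc K) v ∧ contains12 Rp v)) → T (shapeᵇ v)
    shaped h =
      let d , h′      = to T-∧ h
          nat , c     = to T-∧ h′
          inj         = distinct⁻ v d
          p , p-max   = distinct⇒max v inj
          p≡1+r       = trans (to (nAtRight⇔ v inj p-max (suc K)) nat) max-position
      in topAt⁺ r (full ∖ a) w (rest-avoids-first inj)
                (top-after-first p p-max p≡1+r (to (contains⇔shape inj p-max) c))

    shape-of-top : ∀ {p} → toℕ p ≡ r → (∀ x → r < toℕ x → T (above a (lookup w x))) →
                   ContainsShape (Fin.suc p)
    shape-of-top {p} p≡r after = z<s , right
      where
      right : ∀ x → suc (toℕ p) < toℕ x → toℕ a < toℕ (lookup v x)
      right (Fin.suc x) (s≤s p<x) = to T-<ᵇ (after x (subst (_< toℕ x) p≡r p<x))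

    unshaped : T (shapeᵇ v) → T (distinctB v ∧ (nAtRight (suc K) v ∧ contains12 Rp v))
    unshaped h =
      let (inj-w , avoids-a) , (p , p≡r , w[p]≡top , after) = topAt⁻ r (full ∖ a) w h
          inj   = distinct-∷⁺ inj-w (λ y → proj₂ (T-∖⁻ {S = full} (avoids-a y)))
          p-max = trans (cong toℕ w[p]≡top) (toℕ-fromℕ m)
      in from T-∧ (distinct⁺ v inj , from T-∧
           (from (nAtRight⇔ v inj p-max (suc K)) (trans (cong suc p≡r) (sym max-position)) ,
            from (contains⇔shape inj p-max) (shape-of-top p≡r after)))

count-nAtRight-contains : ∀ m k → k < m →
  countSn (suc m) (λ v → nAtRight (suc k) v ∧ contains12 Rp v) ≡ m ! / suc k
count-nAtRight-contains m k k<m =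
  subst (λ n → countSn (suc n) (λ v → nAtRight (suc k) v ∧ contains12 Rp v) ≡ n ! / suc k)
        (trans (sym (+-suc (m ∸ suc k) k)) (m∸n+n≡m k<m))
        (trans (countSn≡count (suc n) _) (trans (count-cong shapeᵇ-spec (allVecs (suc n) (suc n))) count-shapeᵇ))
  where open MaxAtPosition (m ∸ suc k) k renaming (m to n) using (shapeᵇ-spec; count-shapeᵇ)

∑-𝟙[J≡m∸k] : ∀ m J → 0 < J → J ≤ m → ∑[ k < m ] 𝟙 ⌊ J ≟ m ∸ toℕ k ⌋ ≡ 1
∑-𝟙[J≡m∸k] zero    (suc J) _ ()
∑-𝟙[J≡m∸k] (suc m) J 0<J J≤1+m with J ≟ suc m
... | yes refl = cong suc (trans (sum-cong-≗ {m} no-later-k) (sum-replicate-zero m))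
  where
  no-later-k : ∀ k → 𝟙 ⌊ suc m ≟ m ∸ toℕ k ⌋ ≡ 0
  no-later-k k with suc m ≟ m ∸ toℕ k
  ... | yes 1+m≡m∸k = ⊥-elim (<-irrefl (sym 1+m≡m∸k) (s≤s (m∸n≤m m (toℕ k))))
  ... | no _        = refl
... | no J≢1+m = ∑-𝟙[J≡m∸k] m J 0<J (s≤s⁻¹ (≤∧≢⇒< J≤1+m J≢1+m))

𝟙-contains≡∑-nAtRight : ∀ m (v : Vec (Fin (suc m)) (suc m)) →
  𝟙 (distinctB v ∧ contains12 Rp v)
  ≡ ∑[ k < m ] 𝟙 (distinctB v ∧ (nAtRight (suc (toℕ k)) v ∧ contains12 Rp v))
𝟙-contains≡∑-nAtRight m v with distinctB v in d
... | false = sym (sum-replicate-zero m)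
... | true  with contains12 Rp v in c
...   | false =
  sym (trans (sum-cong-≗ {m} (λ k → cong 𝟙 (∧-zeroʳ (nAtRight (suc (toℕ k)) v)))) (sum-replicate-zero m))
...   | true  = sym (begin
  ∑[ k < m ] 𝟙 (nAtRight (suc (toℕ k)) v ∧ true)
    ≡⟨ sum-cong-≗ {m} (λ k → cong 𝟙 (trans (∧-identityʳ _) (nAtRight≡ k))) ⟩
  ∑[ k < m ] 𝟙 ⌊ toℕ p ≟ m ∸ toℕ k ⌋
    ≡⟨ ∑-𝟙[J≡m∸k] m (toℕ p) 0<p (s≤s⁻¹ (toℕ<n p)) ⟩
  1 ∎)
  where
  open ≡-Reasoning
  inj : Distinct v
  inj = distinct⁻ v (from T-≡ d)
  p : Fin (suc m)
  p = proj₁ (distinct⇒max v inj)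
  p-max : toℕ (lookup v p) ≡ m
  p-max = proj₂ (distinct⇒max v inj)
  0<p : 0 < toℕ p
  0<p = proj₁ (to (Containment.contains⇔shape v inj p-max) (from T-≡ c))
  nAtRight≡ : ∀ k → nAtRight (suc (toℕ k)) v ≡ ⌊ toℕ p ≟ m ∸ toℕ k ⌋
  nAtRight≡ k = T-⇔⇒≡ (mk⇔ (from T-≟ ∘ to (nAtRight⇔ v inj p-max (suc (toℕ k))))
                                     (from (nAtRight⇔ v inj p-max (suc (toℕ k))) ∘ to T-≟))

count-avoiders : ∀ m → countSn (suc m) (λ v → not (contains12 Rp v))
                       ≡ suc m ! ∸ sum (map (λ k → m ! / suc k) (upTo m))
count-avoiders m = begin
  countSn (suc m) (λ v → not (contains12 Rp v))
    ≡⟨ countSn≡count (suc m) _ ⟩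
  count (λ v → distinctB v ∧ not (contains12 Rp v)) perms
    ≡⟨ m+n∸m≡n (count (λ v → distinctB v ∧ contains12 Rp v) perms) _ ⟨
  count (λ v → distinctB v ∧ contains12 Rp v) perms + count (λ v → distinctB v ∧ not (contains12 Rp v)) perms
    ∸ count (λ v → distinctB v ∧ contains12 Rp v) perms
    ≡⟨ cong₂ _∸_ (trans (count-∧-not distinctB (contains12 Rp) perms) (count-distinct (suc m))) containers ⟩
  suc m ! ∸ ∑[ k < m ] (m ! / suc (toℕ k))
    ≡⟨ cong (suc m ! ∸_) (sum-upTo (λ k → m ! / suc k) m) ⟨
  suc m ! ∸ sum (map (λ k → m ! / suc k) (upTo m)) ∎
  where
  open ≡-Reasoning
  perms : List (Vec (Fin (suc m)) (suc m))
  perms = allVecs (suc m) (suc m)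
  containers : count (λ v → distinctB v ∧ contains12 Rp v) perms ≡ ∑[ k < m ] (m ! / suc (toℕ k))
  containers = trans (count-∑ {k = m} _ (λ k v → distinctB v ∧ (nAtRight (suc (toℕ k)) v ∧ contains12 Rp v))
                              (𝟙-contains≡∑-nAtRight m) perms) (sum-cong-≗ {m} λ k →
    trans (sym (countSn≡count (suc m) _)) (count-nAtRight-contains m (toℕ k) (toℕ<n k)))

proposition4p11 : (n : ℕ) → 2 ≤ n →
    ((i : ℕ) → (h : 1 ≤ i) → i ≤ n ∸ 1 →
      countSn n (λ v → nAtRight i v ∧ contains12 Rp v) ≡ _/_ ((n ∸ 1) !) i {{>-nonZero h}})
    × (countSn n (λ v → not (contains12 Rp v))
        ≡ n ! ∸ sum (map (λ k → (n ∸ 1) ! / suc k) (upTo (n ∸ 1))))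
proposition4p11 (suc m) _ = containers-at , count-avoiders m
  where
  containers-at : (i : ℕ) → (h : 1 ≤ i) → i ≤ m →
                  countSn (suc m) (λ v → nAtRight i v ∧ contains12 Rp v) ≡ _/_ (m !) i {{>-nonZero h}}
  containers-at (suc k) _ k<m = count-nAtRight-contains m k k<m
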